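{- Let $\theta,\delta$ be congruences of $\mathbf{L}_n$, each with more than one class, such that $\mathrm{ext}(\theta)\cap\mathrm{ext}(\delta)=\{0,n\}$ and $\theta\vee\delta\ne\{0,\dots,n\}^2$. Then $\gcd(\mathsf{f}_\theta,\mathsf{f}_\delta)=1$.
   Context: For an integer $n\ge 1$, the line $\mathbf{L}_n$ is the frame $\langle\{0,\dots,n\},R\rangle$ where $x\mathrel{R}y$ iff $|x-y|\le 1$. A congruence of $\mathbf{L}_n$ is an equivalence relation $\theta$ on $\{0,\dots,n\}$ such that whenever $x'\mathrel{\theta}x$ and $x\mathrel{R}y$ there is $y'$ with $x'\mathrel{R}y'$ and $y'\mathrel{\theta}y$; join = generated equivalence relation. The quotient of $\mathbf{L}_n$ by $\theta$ is isomorphic to a line; the step of $\theta$ is the number of classes minus one; $e$ is an extreme of $\theta$ if $e/\theta$ is an endpoint of the quotient line, $\mathrm{ext}(\theta)$ the set of extremes. A rest is a pair $\langle r,r+1\rangle\in\theta$. Frequency: $\mathsf{f}_\theta=(n-\#\text{rests})/\text{step}$. -}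

module Defs where

open import Data.Nat using (ℕ; zero; suc; _≤_; _∸_; _*_; _<ᵇ_; _≡ᵇ_)
open import Data.Fin using (Fin; toℕ; inject₁) renaming (zero to fzero; suc to fsuc)
open import Data.Bool using (Bool; true; false; not; _∧_; if_then_else_)
open import Data.Product using (Σ; ∃; _×_; _,_)
open import Data.Sum using (_⊎_)
open import Function.Bundles using (_⇔_)
open import Relation.Binary.PropositionalEquality using (_≡_)

-- Points of the line L_n are Fin (suc n) = {0,…,n}.
-- Accessibility relation of L_n: x R y iff |x - y| ≤ 1.
_R_ : ∀ {n} → Fin n → Fin n → Set
x R y = (toℕ x ≤ suc (toℕ y)) × (toℕ y ≤ suc (toℕ x))

BRel : ℕ → Set
BRel m = Fin m → Fin m → Bool

_∋_∼_ : ∀ {m} → BRel m → Fin m → Fin m → Set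
θ ∋ x ∼ y = θ x y ≡ true

record IsEquivalenceB {m} (θ : BRel m) : Set where
  field
    refl  : ∀ x → θ ∋ x ∼ x
    sym   : ∀ x y → θ ∋ x ∼ y → θ ∋ y ∼ x
    trans : ∀ x y z → θ ∋ x ∼ y → θ ∋ y ∼ z → θ ∋ x ∼ z

record IsCongruence (n : ℕ) (θ : BRel (suc n)) : Set where
  field
    equiv : IsEquivalenceB θ
    back  : ∀ x x' y → θ ∋ x' ∼ x → x R y → Σ (Fin (suc n)) λ y' → (x' R y') × (θ ∋ y' ∼ y)

data Join {m} (θ δ : BRel m) : Fin m → Fin m → Set where
  inl   : ∀ {x y} → θ ∋ x ∼ y → Join θ δ x y
  inr   : ∀ {x y} → δ ∋ x ∼ y → Join θ δ x y
  jrefl : ∀ {x} → Join θ δ x x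
  jsym  : ∀ {x y} → Join θ δ x y → Join θ δ y x
  jtrans : ∀ {x y z} → Join θ δ x y → Join θ δ y z → Join θ δ x z

count : ∀ {m} → (Fin m → Bool) → ℕ
count {zero}  p = 0
count {suc m} p = (if p fzero then 1 else 0) Data.Nat.+ count (λ i → p (fsuc i))

isLeastRep : ∀ {m} → BRel m → Fin m → Bool
isLeastRep θ x = count (λ y → (toℕ y <ᵇ toℕ x) ∧ θ y x) ≡ᵇ 0

classes : ∀ {m} → BRel m → ℕ
classes θ = count (isLeastRep θ)

step : ∀ {n} → BRel (suc n) → ℕ
step θ = classes θ ∸ 1

rests : ∀ {n} → BRel (suc n) → ℕ
rests {n} θ = count {n} (λ r → θ (inject₁ r) (fsuc r))

-- An isomorphism of the quotient L_n/θ onto the line L_k, presented as the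
-- surjective quotient map q : {0,…,n} → {0,…,k} whose kernel is θ and which
-- carries the quotient relation ([x] R [y] iff ∃ y' θ y with x R y'; this is the
-- quotient-frame relation since θ is a congruence) exactly onto the relation of L_k.
record QuotIso (n : ℕ) (θ : BRel (suc n)) (k : ℕ) (q : Fin (suc n) → Fin (suc k)) : Set where
  field
    kernel : ∀ x y → (θ ∋ x ∼ y) ⇔ (q x ≡ q y)
    onto   : ∀ (c : Fin (suc k)) → ∃ λ x → q x ≡ c
    rel    : ∀ x y → (∃ λ y' → (θ ∋ y' ∼ y) × (x R y')) ⇔ (q x R q y)

IsExtreme : ∀ {n} → BRel (suc n) → Fin (suc n) → Set
IsExtreme {n} θ e =
  Σ ℕ λ k → Σ (Fin (suc n) → Fin (suc k)) λ q →
    QuotIso n θ k q × ((toℕ (q e) ≡ 0) ⊎ (toℕ (q e) ≡ k))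

module Submission where

-- Numbering the classes of θ by their least elements gives the quotient map
-- q : {0,…,n} → {0,…,K}, K = step θ.  It is a zigzag: it starts at 0, changes by at
-- most one per step, and from every point both adjacent classes are reached at a
-- neighbour.  Such a map runs along the triangle wave 0,1,…,K,K-1,…,0,1,… of height K,
-- advancing one wave position per move (a step that is not a rest).  As q n is an
-- endpoint, the number of moves, n minus the number of rests, is f·K; f is the frequency.
--
-- If θ is contained in a congruence γ, γ's map factors through θ's, so along each half
-- wave of θ the map of γ moves equally often.  Suppose d = gcd(fθ, fδ) > 1 and let γ be
-- the join (proper, so K_γ ≥ 1).  The point where θ has made fθ/d half waves and the point
-- where δ has made fδ/d half waves both come after 1/d of all γ-moves.  Between them γ only
-- rests, and at a θ-extreme a γ-rest is a θ-rest; hence the later point is an extreme of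
-- both θ and δ, but it is neither 0 nor n.  Decidability of the join, needed to present
-- it as a relation, is only available under double negation, which is harmless since
-- gcd(fθ, fδ) ≡ 1 is decidable.

open import Defs
open import Data.Nat
open import Data.Nat.Properties
open import Data.Nat.DivMod using (_/_; _%_; m%n<n; m≡m%n+[m/n]*n)
open import Data.Nat.Divisibility using (_∣_)
open import Data.Nat.GCD using (gcd; gcd[m,n]∣m; gcd[m,n]∣n)
open import Data.Fin using (Fin; toℕ; inject₁; fromℕ<; fromℕ) renaming (zero to fzero; suc to fsuc)
open import Data.Fin.Properties using (toℕ-injective; toℕ-fromℕ<; toℕ-inject₁; toℕ<n; sequence)
open import Data.Bool using (Bool; true; false; T; if_then_else_; _∧_)
open import Data.Bool.Properties using (∧-identityʳ; ∧-zeroʳ)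
open import Data.Product using (Σ; ∃; _×_; _,_; proj₁; proj₂)
open import Data.Sum using (_⊎_; inj₁; inj₂)
open import Data.Empty using (⊥; ⊥-elim)
open import Effect.Monad using (RawMonad)
open import Function.Bundles using (_⇔_; mk⇔; Equivalence)
open import Relation.Nullary using (¬_; Dec; yes; no; does)
open import Relation.Nullary.Decidable using (¬¬-excluded-middle)
open import Relation.Nullary.Negation using (¬¬-Monad)
open import Relation.Binary.PropositionalEquality
open import Algebra.Properties.CommutativeSemigroup +-commutativeSemigroup using (interchange)


sumBelow : ℕ → (ℕ → ℕ) → ℕ
sumBelow zero    c = 0
sumBelow (suc m) c = sumBelow m c + c m

sumBelow-shift : ∀ m c → sumBelow (suc m) c ≡ c 0 + sumBelow m (λ i → c (suc i))
sumBelow-shift zero    c = +-comm 0 (c 0)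
sumBelow-shift (suc m) c =
  trans (cong (_+ c (suc m)) (sumBelow-shift m c)) (+-assoc (c 0) _ _)

count-sumBelow : ∀ {m} (p : Fin m → Bool) (c : ℕ → ℕ) →
  (∀ r → (if p r then 1 else 0) ≡ c (toℕ r)) → count p ≡ sumBelow m c
count-sumBelow {zero}  p c h = refl
count-sumBelow {suc m} p c h =
  trans (cong₂ _+_ (h fzero) (count-sumBelow (λ i → p (fsuc i)) (λ i → c (suc i)) (λ r → h (fsuc r))))
        (sym (sumBelow-shift m c))

sumBelow-complement : ∀ m c d → (∀ i → c i + d i ≡ 1) → sumBelow m c + sumBelow m d ≡ m
sumBelow-complement zero    c d h = refl
sumBelow-complement (suc m) c d h = begin
  (sumBelow m c + c m) + (sumBelow m d + d m) ≡⟨ interchange (sumBelow m c) (c m) (sumBelow m d) (d m) ⟩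
  (sumBelow m c + sumBelow m d) + (c m + d m) ≡⟨ cong₂ _+_ (sumBelow-complement m c d h) (h m) ⟩
  m + 1                                       ≡⟨ +-comm m 1 ⟩
  suc m                                       ∎
  where open ≡-Reasoning

isMove : ℕ → ℕ → ℕ
isMove a b with a ≟ b
... | yes _ = 0
... | no _  = 1

isRest : ℕ → ℕ → ℕ
isRest a b with a ≟ b
... | yes _ = 1
... | no _  = 0

isMove-≡ : ∀ {a b} → a ≡ b → isMove a b ≡ 0
isMove-≡ {a} {b} e with a ≟ b
... | yes _ = refl
... | no ne = ⊥-elim (ne e)

isMove-≢ : ∀ {a b} → a ≢ b → isMove a b ≡ 1
isMove-≢ {a} {b} ne with a ≟ b
... | yes e = ⊥-elim (ne e)
... | no _  = refl

isMove-sym : ∀ a b → isMove a b ≡ isMove b a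
isMove-sym a b with a ≟ b
... | yes e = sym (isMove-≡ (sym e))
... | no ne = sym (isMove-≢ λ e′ → ne (sym e′))

isMove+isRest : ∀ a b → isMove a b + isRest a b ≡ 1
isMove+isRest a b with a ≟ b
... | yes _ = refl
... | no _  = refl

moves : (ℕ → ℕ) → ℕ → ℕ
moves f i = sumBelow i (λ r → isMove (f (suc r)) (f r))

restsBelow : (ℕ → ℕ) → ℕ → ℕ
restsBelow f i = sumBelow i (λ r → isRest (f (suc r)) (f r))

moves+rests : ∀ f i → moves f i + restsBelow f i ≡ i
moves+rests f i = sumBelow-complement i _ _ (λ r → isMove+isRest (f (suc r)) (f r))

moves-rest : ∀ f i → f (suc i) ≡ f i → moves f (suc i) ≡ moves f i
moves-rest f i e = trans (cong (moves f i +_) (isMove-≡ e)) (+-identityʳ (moves f i))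

moves-move : ∀ f i → f (suc i) ≢ f i → moves f (suc i) ≡ suc (moves f i)
moves-move f i ne = trans (cong (moves f i +_) (isMove-≢ ne)) (+-comm (moves f i) 1)

moves-step : ∀ f i → (moves f (suc i) ≡ moves f i) ⊎ (moves f (suc i) ≡ suc (moves f i))
moves-step f i = by-cases (f (suc i) ≟ f i)
  where
  by-cases : Dec (f (suc i) ≡ f i) → (moves f (suc i) ≡ moves f i) ⊎ (moves f (suc i) ≡ suc (moves f i))
  by-cases (yes e) = inj₁ (moves-rest f i e)
  by-cases (no ne) = inj₂ (moves-move f i ne)

moves-mono : ∀ f {i j} → i ≤ j → moves f i ≤ moves f j
moves-mono f {i} {zero} z≤n = ≤-refl
moves-mono f {i} {suc j} i≤1+j with m≤n⇒m<n∨m≡n i≤1+j | moves-step f j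
... | inj₂ refl       | _      = ≤-refl
... | inj₁ (s≤s i≤j) | inj₁ e = ≤-trans (moves-mono f i≤j) (≤-reflexive (sym e))
... | inj₁ (s≤s i≤j) | inj₂ e = ≤-trans (moves-mono f i≤j) (≤-trans (n≤1+n _) (≤-reflexive (sym e)))

moves-still : ∀ f i → moves f (suc i) ≡ moves f i → f (suc i) ≡ f i
moves-still f i still = by-cases (f (suc i) ≟ f i)
  where
  by-cases : Dec (f (suc i) ≡ f i) → f (suc i) ≡ f i
  by-cases (yes rest) = rest
  by-cases (no moved) = ⊥-elim (1+n≢n (trans (sym (moves-move f i moved)) still))

moves-intermediate : ∀ f m x → x ≤ moves f m → Σ ℕ λ i → i ≤ m × moves f i ≡ x
moves-intermediate f zero x x≤0 = 0 , z≤n , sym (≤-antisym x≤0 z≤n)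
moves-intermediate f (suc m) x x≤ with x ≤? moves f m
... | yes x≤m = let (i , i≤m , e) = moves-intermediate f m x x≤m in i , ≤-trans i≤m (n≤1+n m) , e
... | no x≰m with moves-step f m
...   | inj₁ e = ⊥-elim (x≰m (subst (x ≤_) e x≤))
...   | inj₂ e = suc m , ≤-refl , ≤-antisym (≤-trans (≤-reflexive e) (≰⇒> x≰m)) x≤

moves-shift : ∀ f j → moves f (suc j) ≡ isMove (f 1) (f 0) + moves (λ r → f (suc r)) j
moves-shift f j = sumBelow-shift j (λ r → isMove (f (suc r)) (f r))

moves-segment : ∀ f g u j → (∀ r → r ≤ j → f (u + r) ≡ g r) →
  moves f (u + j) ≡ moves f u + moves g j
moves-segment f g u zero h rewrite +-identityʳ u = sym (+-identityʳ (moves f u))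
moves-segment f g u (suc j) h rewrite +-suc u j = begin
  moves f (u + j) + isMove (f (suc (u + j))) (f (u + j))
    ≡⟨ cong₂ (λ a b → a + isMove b (f (u + j))) (moves-segment f g u j λ r r≤j → h r (≤-trans r≤j (n≤1+n j)))
             (trans (cong f (sym (+-suc u j))) (h (suc j) ≤-refl)) ⟩
  moves f u + moves g j + isMove (g (suc j)) (f (u + j))
    ≡⟨ cong (λ b → moves f u + moves g j + isMove (g (suc j)) b) (h j (n≤1+n j)) ⟩
  moves f u + moves g j + isMove (g (suc j)) (g j)
    ≡⟨ +-assoc (moves f u) _ _ ⟩
  moves f u + moves g (suc j) ∎
  where open ≡-Reasoning

moves-segment-reversed : ∀ f g u j → (∀ r → r ≤ j → f (u + r) ≡ g (j ∸ r)) →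
  moves f (u + j) ≡ moves f u + moves g j
moves-segment-reversed f g u zero h rewrite +-identityʳ u = sym (+-identityʳ (moves f u))
moves-segment-reversed f g u (suc j) h rewrite +-suc u j = begin
  moves f (u + j) + isMove (f (suc (u + j))) (f (u + j))
    ≡⟨ cong₂ (λ a b → a + isMove b (f (u + j))) (moves-segment-reversed f g′ u j h′)
             (trans (cong f (sym (+-suc u j))) (trans (h (suc j) ≤-refl) (cong g (n∸n≡0 j)))) ⟩
  moves f u + moves g′ j + isMove (g 0) (f (u + j))
    ≡⟨ cong (λ b → moves f u + moves g′ j + isMove (g 0) b) (trans (h j (n≤1+n j)) (cong g (m+n∸n≡m 1 j))) ⟩
  moves f u + moves g′ j + isMove (g 0) (g 1)
    ≡⟨ +-assoc (moves f u) _ _ ⟩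
  moves f u + (moves g′ j + isMove (g 0) (g 1))
    ≡⟨ cong (moves f u +_) (+-comm (moves g′ j) _) ⟩
  moves f u + (isMove (g 0) (g 1) + moves g′ j)
    ≡⟨ cong (λ b → moves f u + (b + moves g′ j)) (isMove-sym (g 0) (g 1)) ⟩
  moves f u + (isMove (g 1) (g 0) + moves g′ j)
    ≡⟨ cong (moves f u +_) (sym (moves-shift g j)) ⟩
  moves f u + moves g (suc j) ∎
  where
  open ≡-Reasoning
  g′ : ℕ → ℕ
  g′ r = g (suc r)
  h′ : ∀ r → r ≤ j → f (u + r) ≡ g′ (j ∸ r)
  h′ r r≤j = trans (h r (≤-trans r≤j (n≤1+n j))) (cong g (+-∸-assoc 1 r≤j))

moves-factor : ∀ n f g w h → (∀ i → i ≤ n → f i ≡ w (moves f i)) → (∀ i → i ≤ n → g i ≡ h (f i)) →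
  ∀ i → i ≤ n → moves g i ≡ moves (λ s → h (w s)) (moves f i)
moves-factor n f g w h fw gh zero    _     = refl
moves-factor n f g w h fw gh (suc i) 1+i≤n = by-cases (f (suc i) ≟ f i)
  where
  open ≡-Reasoning
  i≤n : i ≤ n
  i≤n = ≤-trans (n≤1+n i) 1+i≤n
  hw : ℕ → ℕ
  hw s = h (w s)
  c : ℕ
  c = moves f i
  IH : moves g i ≡ moves hw c
  IH = moves-factor n f g w h fw gh i i≤n
  by-cases : Dec (f (suc i) ≡ f i) → moves g (suc i) ≡ moves hw (moves f (suc i))
  by-cases (yes e) = begin
    moves g (suc i)             ≡⟨ moves-rest g i (trans (gh (suc i) 1+i≤n) (trans (cong h e) (sym (gh i i≤n)))) ⟩
    moves g i                   ≡⟨ IH ⟩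
    moves hw c                  ≡⟨ cong (moves hw) (sym (moves-rest f i e)) ⟩
    moves hw (moves f (suc i))  ∎
  by-cases (no ne) = begin
    moves g i + isMove (g (suc i)) (g i)
      ≡⟨ cong₂ (λ a b → a + isMove b (g i)) IH (trans (gh (suc i) 1+i≤n) (cong h f-next)) ⟩
    moves hw c + isMove (hw (suc c)) (g i)
      ≡⟨ cong (λ b → moves hw c + isMove (hw (suc c)) b) (trans (gh i i≤n) (cong h (fw i i≤n))) ⟩
    moves hw (suc c)
      ≡⟨ cong (moves hw) (sym (moves-move f i ne)) ⟩
    moves hw (moves f (suc i)) ∎
    where
    f-next : f (suc i) ≡ w (suc c)
    f-next = trans (fw (suc i) 1+i≤n) (cong w (moves-move f i ne))

-- The triangle wave 0, 1, …, K, K-1, …, 1, 0, 1, … of height K ≥ 1, produced by a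
-- machine whose state is the current height together with the direction of travel.
module Wave (K : ℕ) (K≥1 : 1 ≤ K) where

  data Phase : Set where
    ascending descending : ℕ → Phase

  height : Phase → ℕ
  height (ascending v)  = v
  height (descending v) = v

  next : Phase → Phase
  next (ascending v) with suc v ≟ K
  ... | yes _ = descending (suc v)
  ... | no _  = ascending (suc v)
  next (descending zero)          = ascending 0   -- not reachable
  next (descending (suc zero))    = ascending 0
  next (descending (suc (suc v))) = descending (suc v)

  phase : ℕ → Phase
  phase zero    = ascending 0
  phase (suc u) = next (phase u)

  wave : ℕ → ℕ
  wave u = height (phase u)

  Reachable : Phase → Set
  Reachable (ascending v)  = v < K
  Reachable (descending v) = 0 < v × v ≤ K

  next-reachable : ∀ s → Reachable s → Reachable (next s)
  next-reachable (ascending v) v<K with suc v ≟ K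
  ... | yes e = s≤s z≤n , ≤-reflexive e
  ... | no ne = ≤∧≢⇒< v<K ne
  next-reachable (descending (suc zero))    _       = K≥1
  next-reachable (descending (suc (suc v))) (_ , b) = s≤s z≤n , ≤-trans (n≤1+n _) b

  phase-reachable : ∀ u → Reachable (phase u)
  phase-reachable zero    = K≥1
  phase-reachable (suc u) = next-reachable (phase u) (phase-reachable u)

  wave≤K : ∀ u → wave u ≤ K
  wave≤K u = bound (phase u) (phase-reachable u)
    where
    bound : ∀ s → Reachable s → height s ≤ K
    bound (ascending v)  v<K     = <⇒≤ v<K
    bound (descending v) (_ , b) = b

  wave-adjacent : ∀ u → (wave (suc u) ≡ suc (wave u)) ⊎ (suc (wave (suc u)) ≡ wave u)
  wave-adjacent u = adjacent (phase u) (phase-reachable u)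
    where
    adjacent : ∀ s → Reachable s → (height (next s) ≡ suc (height s)) ⊎ (suc (height (next s)) ≡ height s)
    adjacent (ascending v) _ with suc v ≟ K
    ... | yes _ = inj₁ refl
    ... | no _  = inj₁ refl
    adjacent (descending (suc zero))    _ = inj₂ refl
    adjacent (descending (suc (suc v))) _ = inj₂ refl

  -- The same, in the form of the axioms of a zigzag below.
  wave-step : ∀ u → (wave (suc u) ≤ suc (wave u)) × (wave u ≤ suc (wave (suc u))) × (wave (suc u) ≢ wave u)
  wave-step u with wave-adjacent u
  ... | inj₁ e = ≤-reflexive e , ≤-trans (n≤1+n _) (≤-trans (n≤1+n _) (≤-reflexive (cong suc (sym e)))) ,
                 λ e′ → 1+n≢n (trans (sym e) e′)
  ... | inj₂ e = ≤-trans (n≤1+n _) (≤-trans (n≤1+n _) (≤-reflexive (cong suc e))) , ≤-reflexive (sym e) ,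
                 λ e′ → 1+n≢n (trans e (sym e′))

  wave-bottom : ∀ u → wave u ≡ 0 → wave (suc u) ≡ 1
  wave-bottom u = bottom (phase u) (phase-reachable u)
    where
    bottom : ∀ s → Reachable s → height s ≡ 0 → height (next s) ≡ 1
    bottom (ascending zero) _ _ with 1 ≟ K
    ... | yes _ = refl
    ... | no _  = refl
    bottom (descending zero)    (() , _) _
    bottom (descending (suc v)) _        ()

  wave-top : ∀ u → wave u ≡ K → suc (wave (suc u)) ≡ K
  wave-top u = top (phase u) (phase-reachable u)
    where
    top : ∀ s → Reachable s → height s ≡ K → suc (height (next s)) ≡ K
    top (ascending v)              v<K refl = ⊥-elim (<-irrefl refl v<K)
    top (descending (suc zero))    _   e    = e
    top (descending (suc (suc v))) _   e    = e

  wave-no-turn : ∀ u → 0 < wave (suc u) → wave (suc u) < K → wave u ≢ wave (suc (suc u))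
  wave-no-turn u = no-turn (phase u) (phase-reachable u)
    where
    no-turn : ∀ s → Reachable s → 0 < height (next s) → height (next s) < K → height s ≢ height (next (next s))
    no-turn (ascending v) _ _ v+1<K with suc v ≟ K
    ... | yes e = ⊥-elim (<-irrefl e v+1<K)
    ... | no _ with suc (suc v) ≟ K
    ...   | yes _ = λ ()
    ...   | no _  = λ ()
    no-turn (descending (suc zero))          _ () _
    no-turn (descending (suc (suc zero)))    _ _  _ = λ ()
    no-turn (descending (suc (suc (suc v)))) _ _  _ = λ ()

  instance
    K-nonZero : NonZero K
    K-nonZero = >-nonZero K≥1

  K-1 : ℕ
  K-1 = pred K

  1+[K-1] : suc K-1 ≡ K
  1+[K-1] = suc-pred K

  phase-+suc : ∀ u r → phase (u + suc r) ≡ next (phase (u + r))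
  phase-+suc u r rewrite +-suc u r = refl

  K∸[K-1]≡1 : K ∸ K-1 ≡ 1
  K∸[K-1]≡1 = trans (cong (_∸ K-1) (sym 1+[K-1])) (m+n∸n≡m 1 K-1)

  phase-+K : ∀ u → phase (u + K) ≡ next (phase (u + K-1))
  phase-+K u = trans (cong (λ x → phase (u + x)) (sym 1+[K-1])) (phase-+suc u K-1)

  ascent : ∀ u → phase u ≡ ascending 0 → ∀ r → r < K → phase (u + r) ≡ ascending r
  ascent u e zero    _     rewrite +-identityʳ u = e
  ascent u e (suc r) r+1<K rewrite phase-+suc u r | ascent u e r (<-trans (n<1+n r) r+1<K) with suc r ≟ K
  ... | yes e′ = ⊥-elim (<-irrefl e′ r+1<K)
  ... | no _   = refl

  ascent-top : ∀ u → phase u ≡ ascending 0 → phase (u + K) ≡ descending K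
  ascent-top u e rewrite phase-+K u | ascent u e K-1 (≤-reflexive 1+[K-1]) with suc K-1 ≟ K
  ... | yes e′ = cong descending e′
  ... | no ne  = ⊥-elim (ne 1+[K-1])

  ∸-suc : ∀ {k} j → j < k → k ∸ j ≡ suc (k ∸ suc j)
  ∸-suc {suc k} zero    _         = refl
  ∸-suc {suc k} (suc j) (s≤s j<k) = ∸-suc j j<k

  descent : ∀ u → phase u ≡ descending K → ∀ r → r < K → phase (u + r) ≡ descending (K ∸ r)
  descent u e zero    _     rewrite +-identityʳ u = e
  descent u e (suc r) r+1<K rewrite phase-+suc u r | descent u e r (<-trans (n<1+n r) r+1<K)
    | ∸-suc r (<-trans (n<1+n r) r+1<K) | ∸-suc (suc r) r+1<K = refl

  descent-bottom : ∀ u → phase u ≡ descending K → phase (u + K) ≡ ascending 0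
  descent-bottom u e rewrite phase-+K u | descent u e K-1 (≤-reflexive 1+[K-1]) | K∸[K-1]≡1 = refl

  ascent-height : ∀ u → phase u ≡ ascending 0 → ∀ r → r ≤ K → wave (u + r) ≡ r
  ascent-height u e r r≤K with m≤n⇒m<n∨m≡n r≤K
  ... | inj₁ r<K  = cong height (ascent u e r r<K)
  ... | inj₂ refl = cong height (ascent-top u e)

  descent-height : ∀ u → phase u ≡ descending K → ∀ r → r ≤ K → wave (u + r) ≡ K ∸ r
  descent-height u e r r≤K with m≤n⇒m<n∨m≡n r≤K
  ... | inj₁ r<K  = cong height (descent u e r r<K)
  ... | inj₂ refl = trans (cong height (descent-bottom u e)) (sym (n∸n≡0 K))

  AtEnd : Phase → Set
  AtEnd s = (s ≡ ascending 0) ⊎ (s ≡ descending K)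

  phase-period : ∀ t → AtEnd (phase (t * K))
  phase-period zero = inj₁ refl
  phase-period (suc t) with phase-period t
  ... | inj₁ e = inj₂ (trans (cong phase (+-comm K (t * K))) (ascent-top (t * K) e))
  ... | inj₂ e = inj₁ (trans (cong phase (+-comm K (t * K))) (descent-bottom (t * K) e))

  wave-multiple : ∀ t → (wave (t * K) ≡ 0) ⊎ (wave (t * K) ≡ K)
  wave-multiple t with phase-period t
  ... | inj₁ e = inj₁ (cong height e)
  ... | inj₂ e = inj₂ (cong height e)

  wave-end⇒multiple : ∀ u → (wave u ≡ 0) ⊎ (wave u ≡ K) → Σ ℕ λ t → u ≡ t * K
  wave-end⇒multiple u atEnd with u % K | m%n<n u K | m≡m%n+[m/n]*n u K
  ... | zero  | _   | u≡ = u / K , u≡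
  ... | suc r | r<K | u≡ = ⊥-elim (inside (phase-period (u / K)) atEnd)
    where
    u≡′ : u ≡ u / K * K + suc r
    u≡′ = trans u≡ (+-comm (suc r) _)
    climbing : phase (u / K * K) ≡ ascending 0 → wave u ≡ suc r
    climbing e = trans (cong wave u≡′) (ascent-height (u / K * K) e (suc r) (<⇒≤ r<K))
    falling : phase (u / K * K) ≡ descending K → wave u ≡ K ∸ suc r
    falling e = trans (cong wave u≡′) (descent-height (u / K * K) e (suc r) (<⇒≤ r<K))
    inside : AtEnd (phase (u / K * K)) → (wave u ≡ 0) ⊎ (wave u ≡ K) → ⊥
    inside (inj₁ e) (inj₁ w≡0) = 1+n≢0 (trans (sym (climbing e)) w≡0)
    inside (inj₁ e) (inj₂ w≡K) = <-irrefl (trans (sym (climbing e)) w≡K) r<K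
    inside (inj₂ e) (inj₁ w≡0) = <⇒≱ r<K (m∸n≡0⇒m≤n (trans (sym (falling e)) w≡0))
    inside (inj₂ e) (inj₂ w≡K) = 1+n≢0 (+-cancelˡ-≡ K (suc r) 0 (begin
          K + suc r           ≡⟨ cong (_+ suc r) (trans (sym w≡K) (falling e)) ⟩
          (K ∸ suc r) + suc r ≡⟨ m∸n+n≡m (<⇒≤ r<K) ⟩
          K                   ≡⟨ sym (+-identityʳ K) ⟩
          K + 0               ∎))
      where open ≡-Reasoning

  moves-along-wave : ∀ h t → moves (λ u → h (wave u)) (t * K) ≡ t * moves h K
  moves-along-wave h zero    = refl
  moves-along-wave h (suc t) = begin
    moves hw (K + t * K)            ≡⟨ cong (moves hw) (+-comm K (t * K)) ⟩
    moves hw (t * K + K)            ≡⟨ half-period (phase-period t) ⟩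
    moves hw (t * K) + moves h K    ≡⟨ cong (_+ moves h K) (moves-along-wave h t) ⟩
    t * moves h K + moves h K       ≡⟨ +-comm (t * moves h K) _ ⟩
    moves h K + t * moves h K       ∎
    where
    open ≡-Reasoning
    hw : ℕ → ℕ
    hw u = h (wave u)
    half-period : AtEnd (phase (t * K)) → moves hw (t * K + K) ≡ moves hw (t * K) + moves h K
    half-period (inj₁ e) = moves-segment hw h (t * K) K λ r r≤K → cong h (ascent-height (t * K) e r r≤K)
    half-period (inj₂ e) = moves-segment-reversed hw h (t * K) K λ r r≤K → cong h (descent-height (t * K) e r r≤K)

-- A zigzag of height K on {0,…,n}: the shape of the quotient map of a congruence of
-- L_n with K+1 classes.
record IsZigzag (n K : ℕ) (q : ℕ → ℕ) : Set where
  field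
    start     : q 0 ≡ 0
    step-up   : ∀ i → i < n → q (suc i) ≤ suc (q i)
    step-down : ∀ i → i < n → q i ≤ suc (q (suc i))
    bounded   : ∀ i → i ≤ n → q i ≤ K
    reach     : ∀ i c → i ≤ n → c ≤ K → c ≤ suc (q i) → q i ≤ suc c →
                Σ ℕ λ j → j ≤ n × j ≤ suc i × i ≤ suc j × q j ≡ c

Neighbour : ℕ → ℕ → Set
Neighbour p x = (x ≡ suc p) ⊎ (suc x ≡ p)

neighbour-or-self : ∀ {i j} → j ≤ suc i → i ≤ suc j → (j ≡ i) ⊎ Neighbour i j
neighbour-or-self {zero}        {zero}        _         _         = inj₁ refl
neighbour-or-self {zero}        {suc zero}    _         _         = inj₂ (inj₁ refl)
neighbour-or-self {suc zero}    {zero}        _         _         = inj₂ (inj₂ refl)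
neighbour-or-self {suc (suc i)} {zero}        _         (s≤s ())
neighbour-or-self {zero}        {suc (suc j)} (s≤s ())  _
neighbour-or-self {suc i}       {suc j}       (s≤s a)   (s≤s b) with neighbour-or-self a b
... | inj₁ e        = inj₁ (cong suc e)
... | inj₂ (inj₁ e) = inj₂ (inj₁ (cong suc e))
... | inj₂ (inj₂ e) = inj₂ (inj₂ (cong suc e))

neighbour-pigeonhole : ∀ {p x y z} → Neighbour p x → Neighbour p y → Neighbour p z →
  (x ≡ y) ⊎ (x ≡ z) ⊎ (y ≡ z)
neighbour-pigeonhole (inj₁ a) (inj₁ b) _        = inj₁ (trans a (sym b))
neighbour-pigeonhole (inj₂ a) (inj₂ b) _        = inj₁ (suc-injective (trans a (sym b)))
neighbour-pigeonhole (inj₁ a) (inj₂ b) (inj₁ c) = inj₂ (inj₁ (trans a (sym c)))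
neighbour-pigeonhole (inj₁ a) (inj₂ b) (inj₂ c) = inj₂ (inj₂ (suc-injective (trans b (sym c))))
neighbour-pigeonhole (inj₂ a) (inj₁ b) (inj₁ c) = inj₂ (inj₂ (trans b (sym c)))
neighbour-pigeonhole (inj₂ a) (inj₁ b) (inj₂ c) = inj₂ (inj₁ (suc-injective (trans a (sym c))))

module Zigzag {n K : ℕ} {q : ℕ → ℕ} (K≥1 : 1 ≤ K) (Z : IsZigzag n K q) where
  open IsZigzag Z
  open Wave K K≥1 public

  lipschitz : ∀ p a → p ≤ n → a ≤ n → Neighbour p a → (q a ≤ suc (q p)) × (q p ≤ suc (q a))
  lipschitz p a _   a≤n (inj₁ refl) = step-up p a≤n , step-down p a≤n
  lipschitz p a p≤n _   (inj₂ refl) = step-down a p≤n , step-up a p≤n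

  neighbour-with : ∀ p c → p ≤ n → c ≤ K → c ≤ suc (q p) → q p ≤ suc c → c ≢ q p →
    Σ ℕ λ j → j ≤ n × Neighbour p j × q j ≡ c
  neighbour-with p c p≤n c≤K c≤ ≤c c≢ with reach p c p≤n c≤K c≤ ≤c
  ... | j , j≤n , j≤ , ≤j , e with neighbour-or-self j≤ ≤j
  ...   | inj₁ refl = ⊥-elim (c≢ (sym e))
  ...   | inj₂ nb   = j , j≤n , nb , e

  neighbour-above : ∀ p → p ≤ n → q p < K → Σ ℕ λ j → j ≤ n × Neighbour p j × q j ≡ suc (q p)
  neighbour-above p p≤n qp<K =
    neighbour-with p (suc (q p)) p≤n qp<K ≤-refl (≤-trans (n≤1+n _) (n≤1+n _)) 1+n≢n

  neighbour-below : ∀ p → p ≤ n → 0 < q p → Σ ℕ λ j → j ≤ n × Neighbour p j × suc (q j) ≡ q p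
  neighbour-below p p≤n 0<qp with neighbour-with p (pred (q p)) p≤n (≤-trans pred[n]≤n (bounded p p≤n))
                                    (≤-trans pred[n]≤n (n≤1+n _)) (≤-reflexive (sym 1+pred)) pred≢
    where
    1+pred : suc (pred (q p)) ≡ q p
    1+pred = suc-pred (q p) {{>-nonZero 0<qp}}
    pred≢ : pred (q p) ≢ q p
    pred≢ e = 1+n≢n (trans (cong suc (sym e)) 1+pred)
  ... | j , j≤n , nb , qj = j , j≤n , nb , trans (cong suc qj) (suc-pred (q p) {{>-nonZero 0<qp}})

  above≢below : ∀ {p j₁ j₂} → q j₁ ≡ suc (q p) → suc (q j₂) ≡ q p → j₁ ≢ j₂
  above≢below {p} a b refl = <⇒≢ (≤-trans (n<1+n (q p)) (n≤1+n _)) (trans (sym b) (cong suc a))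

  -- So a point at an interior height uses both its neighbours and cannot rest.
  interior-no-rest : ∀ p s → p ≤ n → 0 < q p → q p < K → Neighbour p s → q s ≢ q p
  interior-no-rest p s p≤n 0<qp qp<K nbs qs≡qp
    with neighbour-above p p≤n qp<K | neighbour-below p p≤n 0<qp
  ... | j₁ , _ , nb₁ , a | j₂ , _ , nb₂ , b with neighbour-pigeonhole nb₁ nb₂ nbs
  ...   | inj₁ j₁≡j₂        = above≢below a b j₁≡j₂
  ...   | inj₂ (inj₁ refl) = 1+n≢n (trans (sym a) qs≡qp)
  ...   | inj₂ (inj₂ refl) = 1+n≢n (trans b (sym qs≡qp))

  -- The last point has a single neighbour, so its height is extreme.
  end-extreme : (q n ≡ 0) ⊎ (q n ≡ K)
  end-extreme with q n ≟ 0 | q n ≟ K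
  ... | yes e | _     = inj₁ e
  ... | no _  | yes e = inj₂ e
  ... | no ≢0 | no ≢K with neighbour-above n ≤-refl (≤∧≢⇒< (bounded n ≤-refl) ≢K)
                        | neighbour-below n ≤-refl (n≢0⇒n>0 ≢0)
  ...   | j₁ , j₁≤n , nb₁ , a | j₂ , j₂≤n , nb₂ , b = ⊥-elim (above≢below a b (only-neighbour j₁≤n nb₁ j₂≤n nb₂))
    where
    only-neighbour : ∀ {x y} → x ≤ n → Neighbour n x → y ≤ n → Neighbour n y → x ≡ y
    only-neighbour x≤n (inj₁ refl) _   _           = ⊥-elim (<-irrefl refl x≤n)
    only-neighbour _   (inj₂ _)    y≤n (inj₁ refl) = ⊥-elim (<-irrefl refl y≤n)
    only-neighbour _   (inj₂ a)    _   (inj₂ b)    = suc-injective (trans a (sym b))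

  moving-neighbour : ∀ p → p ≤ n → Σ ℕ λ s → s ≤ n × Neighbour p s × q s ≢ q p
  moving-neighbour p p≤n with q p <? K
  ... | yes qp<K = let (s , s≤n , nb , e) = neighbour-above p p≤n qp<K
                   in s , s≤n , nb , λ e′ → 1+n≢n (trans (sym e) e′)
  ... | no qp≮K  = let (s , s≤n , nb , e) = neighbour-below p p≤n 0<qp
                   in s , s≤n , nb , λ e′ → 1+n≢n (trans e (sym e′))
    where
    0<qp : 0 < q p
    0<qp = ≤-trans K≥1 (≮⇒≥ qp≮K)

  extreme-neighbours : ∀ p a b → p ≤ n → a ≤ n → b ≤ n → Neighbour p a → Neighbour p b →
    (q p ≡ 0) ⊎ (q p ≡ K) → q b ≢ q p → (q a ≡ q p) ⊎ (q a ≡ q b)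
  extreme-neighbours p a b p≤n a≤n b≤n nba nbb ext qb≢qp =
    one-other ext (lipschitz p a p≤n a≤n nba) (bounded a a≤n) (lipschitz p b p≤n b≤n nbb) (bounded b b≤n) qb≢qp
    where
    low : ∀ {x} → x ≤ 1 → (x ≡ 0) ⊎ (x ≡ 1)
    low {zero}        _         = inj₁ refl
    low {suc zero}    _         = inj₂ refl
    low {suc (suc x)} (s≤s ())
    high : ∀ {x} → x ≤ K → K ≤ suc x → (x ≡ K) ⊎ (suc x ≡ K)
    high x≤K K≤1+x with m≤n⇒m<n∨m≡n x≤K
    ... | inj₁ x<K = inj₂ (≤-antisym x<K K≤1+x)
    ... | inj₂ x≡K = inj₁ x≡K
    one-other : ∀ {e x y} → (e ≡ 0) ⊎ (e ≡ K) → (x ≤ suc e) × (e ≤ suc x) → x ≤ K →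
                (y ≤ suc e) × (e ≤ suc y) → y ≤ K → y ≢ e → (x ≡ e) ⊎ (x ≡ y)
    one-other (inj₁ refl) (x≤1 , _) _ (y≤1 , _) _ y≢0 with low x≤1 | low y≤1
    ... | inj₁ x≡0 | _        = inj₁ x≡0
    ... | inj₂ x≡1 | inj₁ y≡0 = ⊥-elim (y≢0 y≡0)
    ... | inj₂ x≡1 | inj₂ y≡1 = inj₂ (trans x≡1 (sym y≡1))
    one-other (inj₂ refl) (_ , K≤1+x) x≤K (_ , K≤1+y) y≤K y≢K with high x≤K K≤1+x | high y≤K K≤1+y
    ... | inj₁ x≡K | _        = inj₁ x≡K
    ... | inj₂ _   | inj₁ y≡K = ⊥-elim (y≢K y≡K)
    ... | inj₂ x<K | inj₂ y<K = inj₂ (suc-injective (trans x<K (sym y<K)))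

  -- The zigzag theorem: q runs along the triangle wave, one wave position per move.
  -- The invariant also records that at an interior height the previous point sits
  -- one position earlier, which fixes the direction of travel.
  OnWave : ℕ → Set
  OnWave i = (q i ≡ wave (moves q i)) ×
             (∀ i′ → i ≡ suc i′ → 0 < q i → q i < K → q i′ ≡ wave (pred (moves q i)))

  -- At an interior height q cannot turn back: if it moved into suc i₀ along the wave,
  -- its next move continues along the wave (the point behind is taken by the way back).
  move-at-interior : ∀ i₀ u → suc (suc i₀) ≤ n → 0 < q (suc i₀) → q (suc i₀) < K →
    q (suc i₀) ≡ wave (suc u) → q i₀ ≡ wave u → q (suc (suc i₀)) ≢ q (suc i₀) →
    q (suc (suc i₀)) ≡ wave (suc (suc u))
  move-at-interior i₀ u 2+i₀≤n 0<qi qi<K on back moved with wave-step (suc u)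
  ... | w≤ , ≤w , w≢ with neighbour-with (suc i₀) (wave (suc (suc u))) (<⇒≤ 2+i₀≤n) (wave≤K (suc (suc u)))
                            (subst (λ x → wave (suc (suc u)) ≤ suc x) (sym on) w≤)
                            (subst (_≤ suc (wave (suc (suc u)))) (sym on) ≤w)
                            (λ e → w≢ (trans e on))
  ...   | j , _ , inj₁ refl , qj = qj
  ...   | j , _ , inj₂ refl , qj =
          ⊥-elim (wave-no-turn u (subst (0 <_) on 0<qi) (subst (_< K) on qi<K) (trans (sym back) qj))

  -- A move of q goes to the next wave position: at the bottom and at the top there
  -- is only one way to go, at an interior height it is move-at-interior.
  move-on-wave : ∀ i → suc i ≤ n → OnWave i → q (suc i) ≢ q i → q (suc i) ≡ wave (suc (moves q i))
  move-on-wave i 1+i≤n (on , back) moved with q i ≟ 0 | q i ≟ K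
  ... | yes qi≡0 | _ = trans (≤1∧≢0 (subst (λ x → q (suc i) ≤ suc x) qi≡0 (step-up i 1+i≤n))
                                   (λ e → moved (trans e (sym qi≡0))))
                             (sym (wave-bottom (moves q i) (trans (sym on) qi≡0)))
    where
    ≤1∧≢0 : ∀ {x} → x ≤ 1 → x ≢ 0 → x ≡ 1
    ≤1∧≢0 {zero}        _        x≢0 = ⊥-elim (x≢0 refl)
    ≤1∧≢0 {suc zero}    _        _   = refl
    ≤1∧≢0 {suc (suc x)} (s≤s ()) _
  ... | no _ | yes qi≡K = suc-injective (trans below-top (sym (wave-top (moves q i) (trans (sym on) qi≡K))))
    where
    below-top : suc (q (suc i)) ≡ K
    below-top = ≤-antisym (≤∧≢⇒< (bounded (suc i) 1+i≤n) (λ e → moved (trans e (sym qi≡K))))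
                          (subst (_≤ suc (q (suc i))) qi≡K (step-down i 1+i≤n))
  ... | no qi≢0 | no qi≢K with i | moves q i | on | back
  ...   | zero   | _     | _   | _     = ⊥-elim (qi≢0 start)
  ...   | suc i₀ | zero  | on′ | _     = ⊥-elim (qi≢0 on′)
  ...   | suc i₀ | suc u | on′ | back′ =
          move-at-interior i₀ u 1+i≤n 0<qi qi<K on′ (back′ i₀ refl 0<qi qi<K) moved
    where
    0<qi : 0 < q (suc i₀)
    0<qi = n≢0⇒n>0 qi≢0
    qi<K : q (suc i₀) < K
    qi<K = ≤∧≢⇒< (bounded (suc i₀) (<⇒≤ 1+i≤n)) qi≢K

  on-wave-step : ∀ i → suc i ≤ n → OnWave i → OnWave (suc i)
  on-wave-step i 1+i≤n inv@(on , _) = by-cases (q (suc i) ≟ q i)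
    where
    by-cases : Dec (q (suc i) ≡ q i) → OnWave (suc i)
    by-cases (yes rest) =
      trans rest (trans on (cong wave (sym (moves-rest q i rest)))) ,
      λ { i′ refl 0<q q<K → ⊥-elim (interior-no-rest (suc i) i 1+i≤n 0<q q<K (inj₂ refl) (sym rest)) }
    by-cases (no moved) =
      trans (move-on-wave i 1+i≤n inv moved) (cong wave (sym (moves-move q i moved))) ,
      λ { i′ refl _ _ → trans on (cong (λ m → wave (pred m)) (sym (moves-move q i moved))) }

  on-wave : ∀ i → i ≤ n → OnWave i
  on-wave zero    _     = start , λ _ ()
  on-wave (suc i) 1+i≤n = on-wave-step i 1+i≤n (on-wave i (≤-trans (n≤1+n i) 1+i≤n))

  follows-wave : ∀ i → i ≤ n → q i ≡ wave (moves q i)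
  follows-wave i i≤n = proj₁ (on-wave i i≤n)

  extreme-at-multiple : ∀ i t → i ≤ n → moves q i ≡ t * K → (q i ≡ 0) ⊎ (q i ≡ K)
  extreme-at-multiple i t i≤n e =
    subst (λ x → (x ≡ 0) ⊎ (x ≡ K)) (sym (trans (follows-wave i i≤n) (cong wave e))) (wave-multiple t)

  -- ... and, as the last height is extreme, the total number of moves is a multiple of K.
  frequency : Σ ℕ λ f → moves q n ≡ f * K
  frequency = wave-end⇒multiple (moves q n) (subst (λ x → (x ≡ 0) ⊎ (x ≡ K)) (follows-wave n ≤-refl) end-extreme)

  -- q is not constant, so it moves at least once.
  moves-nonzero : moves q n ≢ 0
  moves-nonzero none with moving-neighbour 0 z≤n
  ... | s , s≤n , nb , qs≢q0 = qs≢q0 (begin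
    q s               ≡⟨ follows-wave s s≤n ⟩
    wave (moves q s)  ≡⟨ cong wave (≤-antisym (subst (moves q s ≤_) none (moves-mono q s≤n)) z≤n) ⟩
    wave 0            ≡⟨ sym start ⟩
    q 0               ∎)
    where open ≡-Reasoning

slow-growth : ∀ n (f : ℕ → ℕ) → (∀ i → i < n → f (suc i) ≤ suc (f i)) →
  ∀ j d → j + d ≤ n → f (j + d) ≤ f j + d
slow-growth n f step j zero _ rewrite +-identityʳ j = ≤-reflexive (sym (+-identityʳ (f j)))
slow-growth n f step j (suc d) j+1+d≤n rewrite +-suc j d | +-suc (f j) d =
  ≤-trans (step (j + d) j+1+d≤n) (s≤s (slow-growth n f step j d (<⇒≤ j+1+d≤n)))

T⇒≡true : ∀ {b} → T b → b ≡ true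
T⇒≡true {true} _ = refl

≡true⇒T : ∀ {b} → b ≡ true → T b
≡true⇒T refl = _

firstWhere : ∀ {m} → (Fin (suc m) → Bool) → Fin (suc m)
firstWhere {zero}  p = fzero
firstWhere {suc m} p with p fzero
... | true  = fzero
... | false = fsuc (firstWhere (λ i → p (fsuc i)))

firstWhere-first : ∀ {m} (p : Fin (suc m) → Bool) y → p y ≡ true →
  (p (firstWhere p) ≡ true) × (toℕ (firstWhere p) ≤ toℕ y)
firstWhere-first {zero}  p fzero py = py , z≤n
firstWhere-first {suc m} p y py with p fzero in p0
... | true = p0 , z≤n
firstWhere-first {suc m} p fzero    py | false with trans (sym p0) py
... | ()
firstWhere-first {suc m} p (fsuc y) py | false with firstWhere-first (λ i → p (fsuc i)) y py
... | found , least = found , s≤s least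

count-zero⇒ : ∀ {m} (p : Fin m → Bool) → count p ≡ 0 → ∀ y → p y ≡ false
count-zero⇒ {suc m} p c≡0 y with p fzero in p0
count-zero⇒ {suc m} p ()  y        | true
count-zero⇒ {suc m} p c≡0 fzero    | false = p0
count-zero⇒ {suc m} p c≡0 (fsuc y) | false = count-zero⇒ (λ i → p (fsuc i)) c≡0 y

count-zero : ∀ {m} (p : Fin m → Bool) → (∀ y → p y ≡ false) → count p ≡ 0
count-zero {zero}  p none = refl
count-zero {suc m} p none rewrite none fzero = count-zero (λ i → p (fsuc i)) (λ y → none (fsuc y))

count-≤ : ∀ {m} (p : Fin m → Bool) → count p ≤ m
count-≤ {zero}  p = z≤n
count-≤ {suc m} p with p fzero
... | true  = s≤s (count-≤ (λ i → p (fsuc i)))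
... | false = ≤-trans (count-≤ (λ i → p (fsuc i))) (n≤1+n m)

DownClosed : ∀ {m} → (Fin m → Bool) → Set
DownClosed P = ∀ x y → P x ≡ true → toℕ y ≤ toℕ x → P y ≡ true

count-downClosed : ∀ {m} (P : Fin m → Bool) → DownClosed P → ∀ x → (P x ≡ true) ⇔ (toℕ x < count P)
count-downClosed {suc m} P down x with P fzero in P0
... | false = mk⇔ (λ Px → ⊥-elim (false≢true (trans (sym P0) (down x fzero Px z≤n))))
                  (λ x<0 → ⊥-elim (n≮0 (subst (toℕ x <_) none x<0)))
  where
  false≢true : false ≢ true
  false≢true ()
  none : count (λ i → P (fsuc i)) ≡ 0
  none = count-zero _ λ y → ¬true (P (fsuc y)) refl
    where
    ¬true : ∀ {y} b → P (fsuc y) ≡ b → b ≡ false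
    ¬true false _  = refl
    ¬true true  Py = ⊥-elim (false≢true (trans (sym P0) (down (fsuc _) fzero Py z≤n)))
... | true with x
...   | fzero  = mk⇔ (λ _ → s≤s z≤n) (λ _ → P0)
...   | fsuc y = let rest = count-downClosed (λ i → P (fsuc i)) (λ a b Pa b≤a → down (fsuc a) (fsuc b) Pa (s≤s b≤a)) y
                 in mk⇔ (λ Py → s≤s (Equivalence.to rest Py)) (λ { (s≤s y<c) → Equivalence.from rest y<c })

-- The point of {0,…,n} with a given coordinate (clamped to n).
abstract
  point : ∀ n → ℕ → Fin (suc n)
  point n i with i ≤? n
  ... | yes i≤n = fromℕ< (s≤s i≤n)
  ... | no _    = fromℕ n

  toℕ-point : ∀ n i → i ≤ n → toℕ (point n i) ≡ i
  toℕ-point n i i≤n with i ≤? n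
  ... | yes i≤n′ = toℕ-fromℕ< (s≤s i≤n′)
  ... | no i≰n   = ⊥-elim (i≰n i≤n)

  point-toℕ : ∀ n x → point n (toℕ x) ≡ x
  point-toℕ n x = toℕ-injective (toℕ-point n (toℕ x) (s≤s⁻¹ (toℕ<n x)))

-- The quotient map of a congruence θ of L_n: a point goes to the least element of its
-- class, and the classes are numbered by these least elements, which form an initial
-- segment {0,…,step θ}.  Read on coordinates, the map is a zigzag of height step θ.
module Quotient (n : ℕ) (θ : BRel (suc n)) (C : IsCongruence n θ) where
  open IsCongruence C
  open IsEquivalenceB equiv renaming (refl to θ-refl; sym to θ-sym; trans to θ-trans)

  abstract
    rep : Fin (suc n) → Fin (suc n)
    rep x = firstWhere (λ y → θ y x)

    rep-related : ∀ x → θ ∋ rep x ∼ x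
    rep-related x = proj₁ (firstWhere-first (λ y → θ y x) x (θ-refl x))

    rep-least : ∀ x y → θ ∋ y ∼ x → toℕ (rep x) ≤ toℕ y
    rep-least x y y∼x = proj₂ (firstWhere-first (λ y → θ y x) y y∼x)

  index : Fin (suc n) → ℕ
  index x = toℕ (rep x)

  index≤ : ∀ x → index x ≤ toℕ x
  index≤ x = rep-least x x (θ-refl x)

  index-kernel : ∀ x y → (θ ∋ x ∼ y) ⇔ (index x ≡ index y)
  index-kernel x y = mk⇔
    (λ x∼y → ≤-antisym (rep-least x (rep y) (θ-trans _ _ _ (rep-related y) (θ-sym _ _ x∼y)))
                       (rep-least y (rep x) (θ-trans _ _ _ (rep-related x) x∼y)))
    (λ e → θ-trans _ _ _ (θ-sym _ _ (rep-related x))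
                         (subst (λ z → θ ∋ z ∼ y) (sym (toℕ-injective e)) (rep-related y)))

  index-rep : ∀ x → index (rep x) ≡ index x
  index-rep x = Equivalence.to (index-kernel (rep x) x) (rep-related x)

  -- The back condition at rep x: indices of related points are at distance at most one ...
  index-step : ∀ x y → x R y → index y ≤ suc (index x)
  index-step x y xRy with back x (rep x) y (rep-related x) xRy
  ... | y′ , (_ , y′≤) , y′∼y = ≤-trans (rep-least y y′ y′∼y) y′≤

  index-reach : ∀ x z → index z ≤ suc (index x) → index x ≤ suc (index z) →
    Σ (Fin (suc n)) λ y → (x R y) × (θ ∋ y ∼ z)
  index-reach x z z≤ x≤ with back (rep x) x (rep z) (θ-sym _ _ (rep-related x)) (x≤ , z≤)
  ... | y , xRy , y∼rz = y , xRy , θ-trans _ _ _ y∼rz (rep-related z)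

  q : ℕ → ℕ
  q i = index (point n i)

  -- Steps between adjacent coordinates are steps of the line, so q grows by at most one.
  q-toℕ : ∀ x → q (toℕ x) ≡ index x
  q-toℕ x = cong index (point-toℕ n x)

  points-related : ∀ i j → i ≤ n → j ≤ n → i ≤ suc j → j ≤ suc i → point n i R point n j
  points-related i j i≤n j≤n i≤ j≤ rewrite toℕ-point n i i≤n | toℕ-point n j j≤n = i≤ , j≤

  q-step-up : ∀ i → i < n → q (suc i) ≤ suc (q i)
  q-step-up i i<n = index-step _ _ (points-related i (suc i) (<⇒≤ i<n) i<n (≤-trans (n≤1+n i) (n≤1+n _)) ≤-refl)

  q-step-down : ∀ i → i < n → q i ≤ suc (q (suc i))
  q-step-down i i<n = index-step _ _ (points-related (suc i) i i<n (<⇒≤ i<n) ≤-refl (≤-trans (n≤1+n i) (n≤1+n _)))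

  leastRep⇒ : ∀ x → isLeastRep θ x ≡ true → index x ≡ toℕ x
  leastRep⇒ x least = ≤-antisym (index≤ x) (≮⇒≥ λ rx<x → false≢true (begin
    false                                        ≡⟨ sym (count-zero⇒ (λ y → (toℕ y <ᵇ toℕ x) ∧ θ y x) none (rep x)) ⟩
    (toℕ (rep x) <ᵇ toℕ x) ∧ θ (rep x) x          ≡⟨ cong ((toℕ (rep x) <ᵇ toℕ x) ∧_) (rep-related x) ⟩
    (toℕ (rep x) <ᵇ toℕ x) ∧ true                 ≡⟨ ∧-identityʳ _ ⟩
    toℕ (rep x) <ᵇ toℕ x                          ≡⟨ T⇒≡true (<⇒<ᵇ rx<x) ⟩
    true                                         ∎))
    where
    open ≡-Reasoning
    false≢true : false ≢ true
    false≢true ()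
    none : count (λ y → (toℕ y <ᵇ toℕ x) ∧ θ y x) ≡ 0
    none = ≡ᵇ⇒≡ _ 0 (≡true⇒T least)

  ⇒leastRep : ∀ x → index x ≡ toℕ x → isLeastRep θ x ≡ true
  ⇒leastRep x ix≡x = T⇒≡true (≡⇒≡ᵇ _ 0 (count-zero (λ y → (toℕ y <ᵇ toℕ x) ∧ θ y x) no-smaller))
    where
    no-smaller : ∀ y → ((toℕ y <ᵇ toℕ x) ∧ θ y x) ≡ false
    no-smaller y with θ y x in y∼x | toℕ y <ᵇ toℕ x in y<x
    ... | false | b     = ∧-zeroʳ b
    ... | true  | false = refl
    ... | true  | true  = ⊥-elim (<⇒≱ (<ᵇ⇒< _ _ (≡true⇒T y<x)) (subst (_≤ toℕ y) ix≡x (rep-least x y y∼x)))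

  -- Least elements are closed downwards, since q grows by at most one per step.
  leastRep-down : DownClosed (isLeastRep θ)
  leastRep-down x y least y≤x = ⇒leastRep y (≤-antisym (index≤ y) (+-cancelʳ-≤ d (toℕ y) (index y) y+d≤))
    where
    d : ℕ
    d = toℕ x ∸ toℕ y
    y+d≡x : toℕ y + d ≡ toℕ x
    y+d≡x = m+[n∸m]≡n y≤x
    y+d≤ : toℕ y + d ≤ index y + d
    y+d≤ = begin
      toℕ y + d      ≡⟨ trans y+d≡x (sym (leastRep⇒ x least)) ⟩
      index x        ≡⟨ sym (trans (cong q y+d≡x) (q-toℕ x)) ⟩
      q (toℕ y + d)  ≤⟨ slow-growth n q q-step-up (toℕ y) d (subst (_≤ n) (sym y+d≡x) (s≤s⁻¹ (toℕ<n x))) ⟩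
      q (toℕ y) + d  ≡⟨ cong (_+ d) (q-toℕ y) ⟩
      index y + d    ∎
      where open ≤-Reasoning

  leastRep⇔small : ∀ x → (isLeastRep θ x ≡ true) ⇔ (toℕ x < classes θ)
  leastRep⇔small = count-downClosed (isLeastRep θ) leastRep-down

  index<classes : ∀ x → index x < classes θ
  index<classes x = Equivalence.to (leastRep⇔small (rep x)) (⇒leastRep (rep x) (index-rep x))

  q-small : ∀ c → c < classes θ → q c ≡ c
  q-small c c<cl =
    trans (leastRep⇒ (point n c) (Equivalence.from (leastRep⇔small (point n c)) (subst (_< classes θ) (sym toℕ-c) c<cl)))
          toℕ-c
    where
    toℕ-c : toℕ (point n c) ≡ c
    toℕ-c = toℕ-point n c (s≤s⁻¹ (≤-trans c<cl (count-≤ (isLeastRep θ))))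

  <classes⇔≤step : ∀ c → (c < classes θ) ⇔ (c ≤ step θ)
  <classes⇔≤step c = mk⇔
    (λ c<cl → subst (_≤ step θ) (m+n∸n≡m c 1) (∸-monoˡ-≤ 1 (subst (_≤ classes θ) (+-comm 1 c) c<cl)))
    (λ c≤ → ≤-trans (s≤s c≤) (≤-reflexive (trans (+-comm 1 (step θ)) (m∸n+n≡m classes>0))))
    where
    classes>0 : 1 ≤ classes θ
    classes>0 = ≤-trans (s≤s z≤n) (index<classes (point n 0))

  index≤step : ∀ x → index x ≤ step θ
  index≤step x = Equivalence.to (<classes⇔≤step _) (index<classes x)

  zigzag : IsZigzag n (step θ) q
  zigzag = record
    { start     = ≤-antisym (subst (q 0 ≤_) (toℕ-point n 0 z≤n) (index≤ (point n 0))) z≤n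
    ; step-up   = q-step-up
    ; step-down = q-step-down
    ; bounded   = λ i _ → index≤step (point n i)
    ; reach     = reach
    }
    where
    reach : ∀ i c → i ≤ n → c ≤ step θ → c ≤ suc (q i) → q i ≤ suc c →
            Σ ℕ λ j → j ≤ n × j ≤ suc i × i ≤ suc j × q j ≡ c
    reach i c i≤n c≤K c≤ ≤c with index-reach (point n i) (point n c) (subst (_≤ suc (q i)) (sym qc) c≤)
                                                                     (subst (λ z → q i ≤ suc z) (sym qc) ≤c)
      where
      qc : q c ≡ c
      qc = q-small c (Equivalence.from (<classes⇔≤step c) c≤K)
    ... | y , (i≤ , y≤) , y∼c =
      toℕ y , s≤s⁻¹ (toℕ<n y) ,
      subst (λ z → toℕ y ≤ suc z) (toℕ-point n i i≤n) y≤ ,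
      subst (λ z → z ≤ suc (toℕ y)) (toℕ-point n i i≤n) i≤ ,
      trans (q-toℕ y) (trans (Equivalence.to (index-kernel _ _) y∼c) (q-small c (Equivalence.from (<classes⇔≤step c) c≤K)))

  rests≡ : rests θ ≡ restsBelow q n
  rests≡ = count-sumBelow _ _ rest-indicator
    where
    left : ∀ (r : Fin n) → inject₁ r ≡ point n (toℕ r)
    left r = trans (sym (point-toℕ n (inject₁ r))) (cong (point n) (toℕ-inject₁ r))
    right : ∀ (r : Fin n) → fsuc r ≡ point n (suc (toℕ r))
    right r = sym (point-toℕ n (fsuc r))
    rest-indicator : ∀ (r : Fin n) → (if θ (inject₁ r) (fsuc r) then 1 else 0) ≡ isRest (q (suc (toℕ r))) (q (toℕ r))
    rest-indicator r with q (suc (toℕ r)) ≟ q (toℕ r)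
    ... | yes e rewrite left r | right r | Equivalence.from (index-kernel _ _) (sym e) = refl
    ... | no ne with θ (inject₁ r) (fsuc r) in r∼r+1
    ...   | true  = ⊥-elim (ne (sym (Equivalence.to (index-kernel _ _) (subst₂ (θ ∋_∼_) (left r) (right r) r∼r+1))))
    ...   | false = refl

  quotientMap : Fin (suc n) → Fin (suc (step θ))
  quotientMap x = fromℕ< (s≤s (index≤step x))

  toℕ-quotientMap : ∀ x → toℕ (quotientMap x) ≡ index x
  toℕ-quotientMap x = toℕ-fromℕ< (s≤s (index≤step x))

  quotientIso : QuotIso n θ (step θ) quotientMap
  quotientIso = record
    { kernel = λ x y → mk⇔ (λ x∼y → toℕ-injective (index-eq x y (Equivalence.to (index-kernel x y) x∼y)))
                           (λ e → Equivalence.from (index-kernel x y) (eq-index x y (cong toℕ e)))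
    ; onto   = λ c → point n (toℕ c) ,
                     toℕ-injective (trans (toℕ-quotientMap _)
                                          (q-small (toℕ c) (Equivalence.from (<classes⇔≤step _) (s≤s⁻¹ (toℕ<n c)))))
    ; rel    = λ x y → mk⇔ (to x y) (from x y)
    }
    where
    index-eq : ∀ x y → index x ≡ index y → toℕ (quotientMap x) ≡ toℕ (quotientMap y)
    index-eq x y e = trans (toℕ-quotientMap x) (trans e (sym (toℕ-quotientMap y)))
    eq-index : ∀ x y → toℕ (quotientMap x) ≡ toℕ (quotientMap y) → index x ≡ index y
    eq-index x y e = trans (sym (toℕ-quotientMap x)) (trans e (toℕ-quotientMap y))
    to : ∀ x y → (∃ λ y′ → (θ ∋ y′ ∼ y) × (x R y′)) → quotientMap x R quotientMap y
    to x y (y′ , y′∼y , (x≤ , y′≤)) rewrite toℕ-quotientMap x | toℕ-quotientMap y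
                                          | sym (Equivalence.to (index-kernel _ _) y′∼y) =
      index-step y′ x (y′≤ , x≤) , index-step x y′ (x≤ , y′≤)
    from : ∀ x y → quotientMap x R quotientMap y → ∃ λ y′ → (θ ∋ y′ ∼ y) × (x R y′)
    from x y (x≤ , y≤) with index-reach x y (subst₂ (λ u v → u ≤ suc v) (toℕ-quotientMap y) (toℕ-quotientMap x) y≤)
                                            (subst₂ (λ u v → u ≤ suc v) (toℕ-quotientMap x) (toℕ-quotientMap y) x≤)
    ... | y′ , xRy′ , y′∼y = y′ , y′∼y , xRy′

  extreme : ∀ x → (index x ≡ 0) ⊎ (index x ≡ step θ) → IsExtreme θ x
  extreme x (inj₁ e) = step θ , quotientMap , quotientIso , inj₁ (trans (toℕ-quotientMap x) e)
  extreme x (inj₂ e) = step θ , quotientMap , quotientIso , inj₂ (trans (toℕ-quotientMap x) e)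

module Congruence (n : ℕ) (θ : BRel (suc n)) (C : IsCongruence n θ) (K≥1 : 1 ≤ step θ) where
  open Quotient n θ C public
  open Zigzag K≥1 zigzag public

  moves≡ : moves q n ≡ n ∸ rests θ
  moves≡ = sym (begin
    n ∸ rests θ                       ≡⟨ cong (n ∸_) rests≡ ⟩
    n ∸ restsBelow q n                ≡⟨ cong (_∸ restsBelow q n) (sym (moves+rests q n)) ⟩
    moves q n + restsBelow q n ∸ restsBelow q n ≡⟨ m+n∸n≡m (moves q n) (restsBelow q n) ⟩
    moves q n                         ∎)
    where open ≡-Reasoning

module Nested (n : ℕ) (θ γ : BRel (suc n)) (Cθ : IsCongruence n θ) (Cγ : IsCongruence n γ)
  (θ⊆γ : ∀ x y → θ ∋ x ∼ y → γ ∋ x ∼ y) (Kθ≥1 : 1 ≤ step θ) (Kγ≥1 : 1 ≤ step γ) where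
  module Θ = Congruence n θ Cθ Kθ≥1
  module Γ = Congruence n γ Cγ Kγ≥1

  coarser : ∀ i j → Θ.q i ≡ Θ.q j → Γ.q i ≡ Γ.q j
  coarser i j e = Equivalence.to (Γ.index-kernel _ _) (θ⊆γ _ _ (Equivalence.from (Θ.index-kernel _ _) e))

  -- The θ-index of a point is a θ-related point.
  factor : ∀ i → i ≤ n → Γ.q i ≡ Γ.q (Θ.q i)
  factor i _ = sym (coarser (Θ.q i) i (Θ.q-small (Θ.q i) (Θ.index<classes _)))

  moves-nested : ∀ t i → i ≤ n → moves Θ.q i ≡ t * step θ → moves Γ.q i ≡ t * moves Γ.q (step θ)
  moves-nested t i i≤n e = begin
    moves Γ.q i                                      ≡⟨ moves-factor n Θ.q Γ.q Θ.wave Γ.q Θ.follows-wave factor i i≤n ⟩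
    moves (λ s → Γ.q (Θ.wave s)) (moves Θ.q i)       ≡⟨ cong (moves (λ s → Γ.q (Θ.wave s))) e ⟩
    moves (λ s → Γ.q (Θ.wave s)) (t * step θ)        ≡⟨ Θ.moves-along-wave Γ.q t ⟩
    t * moves Γ.q (step θ)                           ∎
    where open ≡-Reasoning

  moves-fraction : ∀ f t d i → i ≤ n → moves Θ.q n ≡ f * step θ → f ≡ t * d → moves Θ.q i ≡ t * step θ →
    d * moves Γ.q i ≡ moves Γ.q n
  moves-fraction f t d i i≤n total f≡ part = begin
    d * moves Γ.q i               ≡⟨ cong (d *_) (moves-nested t i i≤n part) ⟩
    d * (t * moves Γ.q (step θ))   ≡⟨ sym (*-assoc d t _) ⟩
    d * t * moves Γ.q (step θ)     ≡⟨ cong (_* moves Γ.q (step θ)) (trans (*-comm d t) (sym f≡)) ⟩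
    f * moves Γ.q (step θ)         ≡⟨ sym (moves-nested f n ≤-refl total) ⟩
    moves Γ.q n                   ∎
    where open ≡-Reasoning

  -- At a θ-extreme point, a γ-rest is a θ-rest: otherwise all neighbours of p would be
  -- γ-related to p (the one behind is at one of the two θ-heights around the extreme).
  rest-at-extreme : ∀ p → suc p ≤ n → (Θ.q p ≡ 0) ⊎ (Θ.q p ≡ step θ) → Γ.q (suc p) ≡ Γ.q p → Θ.q (suc p) ≡ Θ.q p
  rest-at-extreme p 1+p≤n ext γ-rest = by-cases (Θ.q (suc p) ≟ Θ.q p)
    where
    p≤n : p ≤ n
    p≤n = ≤-trans (n≤1+n p) 1+p≤n
    γ-still : Θ.q (suc p) ≢ Θ.q p → ∀ s → Neighbour p s → Γ.q s ≡ Γ.q p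
    γ-still θ-move s (inj₁ refl) = γ-rest
    γ-still θ-move s (inj₂ 1+s≡p)
      with Θ.extreme-neighbours p s (suc p) p≤n s≤n 1+p≤n (inj₂ 1+s≡p) (inj₁ refl) ext θ-move
      where
      s≤n : s ≤ n
      s≤n = ≤-trans (n≤1+n s) (subst (_≤ n) (sym 1+s≡p) p≤n)
    ... | inj₁ e = coarser s p e
    ... | inj₂ e = trans (coarser s (suc p) e) γ-rest
    by-cases : Dec (Θ.q (suc p) ≡ Θ.q p) → Θ.q (suc p) ≡ Θ.q p
    by-cases (yes θ-rest) = θ-rest
    by-cases (no θ-move) with Γ.moving-neighbour p p≤n
    ... | s , _ , nb , moved = ⊥-elim (moved (γ-still θ-move s nb))

  rests-propagate : ∀ i t → moves Θ.q i ≡ t * step θ → ∀ d → i + d ≤ n →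
    moves Γ.q (i + d) ≡ moves Γ.q i → moves Θ.q (i + d) ≡ moves Θ.q i
  rests-propagate i t whole zero    _      _       = cong (moves Θ.q) (+-identityʳ i)
  rests-propagate i t whole (suc d) i+d<n γ-still = trans (cong (moves Θ.q) (+-suc i d)) θ-still
    where
    p : ℕ
    p = i + d
    1+p≤n : suc p ≤ n
    1+p≤n = subst (_≤ n) (+-suc i d) i+d<n
    p≤n : p ≤ n
    p≤n = ≤-trans (n≤1+n p) 1+p≤n
    γ-next : moves Γ.q (suc p) ≡ moves Γ.q i
    γ-next = trans (cong (moves Γ.q) (sym (+-suc i d))) γ-still
    γ-here : moves Γ.q p ≡ moves Γ.q i
    γ-here = ≤-antisym (≤-trans (moves-mono Γ.q (n≤1+n p)) (≤-reflexive γ-next)) (moves-mono Γ.q (m≤m+n i d))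
    θ-here : moves Θ.q p ≡ moves Θ.q i
    θ-here = rests-propagate i t whole d p≤n γ-here
    θ-rest : Θ.q (suc p) ≡ Θ.q p
    θ-rest = rest-at-extreme p 1+p≤n (Θ.extreme-at-multiple p t p≤n (trans θ-here whole))
                             (moves-still Γ.q p (trans γ-next (sym γ-here)))
    θ-still : moves Θ.q (suc p) ≡ moves Θ.q i
    θ-still = trans (moves-rest Θ.q p θ-rest) θ-here

  catch-up : ∀ i j t → i ≤ j → j ≤ n → moves Θ.q i ≡ t * step θ → moves Γ.q j ≡ moves Γ.q i →
    moves Θ.q j ≡ t * step θ
  catch-up i j t i≤j j≤n whole γ-same = begin
    moves Θ.q j                ≡⟨ cong (moves Θ.q) (sym i+[j∸i]) ⟩
    moves Θ.q (i + (j ∸ i))    ≡⟨ rests-propagate i t whole (j ∸ i) (subst (_≤ n) (sym i+[j∸i]) j≤n)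
                                                  (trans (cong (moves Γ.q) i+[j∸i]) γ-same) ⟩
    moves Θ.q i                ≡⟨ whole ⟩
    t * step θ                 ∎
    where
    open ≡-Reasoning
    i+[j∸i] : i + (j ∸ i) ≡ j
    i+[j∸i] = m+[n∸m]≡n i≤j

-- Every relation on a finite set is decidable up to double negation; this suffices
-- when proving a decidable goal.
¬¬-all : ∀ {m} {P : Fin m → Set} → (∀ i → ¬ ¬ P i) → ¬ ¬ (∀ i → P i)
¬¬-all = sequence (RawMonad.rawApplicative ¬¬-Monad)

¬¬-decidable : ∀ {m} (P : Fin m → Fin m → Set) → ¬ ¬ (∀ x y → Dec (P x y))
¬¬-decidable P = ¬¬-all λ x → ¬¬-all λ y → ¬¬-excluded-middle

module JoinBack (n : ℕ) (θ δ : BRel (suc n)) (Cθ : IsCongruence n θ) (Cδ : IsCongruence n δ) where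
  open IsCongruence

  Back : Fin (suc n) → Fin (suc n) → Set
  Back a b = ∀ y → b R y → Σ (Fin (suc n)) λ y′ → (a R y′) × Join θ δ y′ y

  join-back : ∀ {a b} → Join θ δ a b → Back a b × Back b a
  join-back {a} {b} (inl a∼b) =
    (λ y r → let (y′ , r′ , t) = back Cθ b a y a∼b r in y′ , r′ , inl t) ,
    (λ y r → let (y′ , r′ , t) = back Cθ a b y (IsEquivalenceB.sym (equiv Cθ) _ _ a∼b) r in y′ , r′ , inl t)
  join-back {a} {b} (inr a∼b) =
    (λ y r → let (y′ , r′ , t) = back Cδ b a y a∼b r in y′ , r′ , inr t) ,
    (λ y r → let (y′ , r′ , t) = back Cδ a b y (IsEquivalenceB.sym (equiv Cδ) _ _ a∼b) r in y′ , r′ , inr t)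
  join-back jrefl          = (λ y r → y , r , jrefl) , (λ y r → y , r , jrefl)
  join-back (jsym j)       = proj₂ (join-back j) , proj₁ (join-back j)
  join-back (jtrans j₁ j₂) =
    (λ y r → let (y₁ , r₁ , t₁) = proj₁ (join-back j₂) y r
                 (y₂ , r₂ , t₂) = proj₁ (join-back j₁) y₁ r₁
             in y₂ , r₂ , jtrans t₂ t₁) ,
    (λ y r → let (y₁ , r₁ , t₁) = proj₂ (join-back j₁) y r
                 (y₂ , r₂ , t₂) = proj₂ (join-back j₂) y₁ r₁
             in y₂ , r₂ , jtrans t₂ t₁)

  module Decided (dec : ∀ x y → Dec (Join θ δ x y)) where
    γ : BRel (suc n)
    γ x y = does (dec x y)

    γ⇔Join : ∀ x y → (γ ∋ x ∼ y) ⇔ Join θ δ x y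
    γ⇔Join x y with dec x y
    ... | yes j = mk⇔ (λ _ → j) (λ _ → refl)
    ... | no ¬j = mk⇔ (λ ()) (λ j → ⊥-elim (¬j j))

    toJoin : ∀ x y → γ ∋ x ∼ y → Join θ δ x y
    toJoin x y = Equivalence.to (γ⇔Join x y)

    fromJoin : ∀ x y → Join θ δ x y → γ ∋ x ∼ y
    fromJoin x y = Equivalence.from (γ⇔Join x y)

    Cγ : IsCongruence n γ
    Cγ = record
      { equiv = record
          { refl  = λ x → fromJoin x x jrefl
          ; sym   = λ x y x∼y → fromJoin y x (jsym (toJoin x y x∼y))
          ; trans = λ x y z x∼y y∼z → fromJoin x z (jtrans (toJoin x y x∼y) (toJoin y z y∼z)) }
      ; back  = λ x x′ y x′∼x r → let (y′ , r′ , j) = proj₁ (join-back (toJoin x′ x x′∼x)) y r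
                                  in y′ , r′ , fromJoin y′ y j
      }

single-class : ∀ n (θ : BRel (suc n)) (C : IsCongruence n θ) → ¬ (1 ≤ step θ) → ∀ x y → θ ∋ x ∼ y
single-class n θ C ¬K≥1 x y = Equivalence.from (index-kernel x y) (trans (index-zero x) (sym (index-zero y)))
  where
  open Quotient n θ C
  index-zero : ∀ x → index x ≡ 0
  index-zero x = ≤-antisym (≤-trans (index≤step x) (≮⇒≥ ¬K≥1)) z≤n

module CommonDivisor (n : ℕ) (θ δ : BRel (suc n)) (Cθ : IsCongruence n θ) (Cδ : IsCongruence n δ)
  (Kθ≥1 : 1 ≤ step θ) (Kδ≥1 : 1 ≤ step δ)
  (extremes : ∀ e → (IsExtreme θ e × IsExtreme δ e) ⇔ ((toℕ e ≡ 0) ⊎ (toℕ e ≡ n)))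
  (proper : ¬ (∀ x y → Join θ δ x y))
  (fθ fδ : ℕ)
  (hθ : moves (Quotient.q n θ Cθ) n ≡ fθ * step θ)
  (hδ : moves (Quotient.q n δ Cδ) n ≡ fδ * step δ)
  (dec : ∀ x y → Dec (Join θ δ x y)) where
  open JoinBack n θ δ Cθ Cδ
  open Decided dec

  Kγ≥1 : 1 ≤ step γ
  Kγ≥1 with 1 ≤? step γ
  ... | yes K≥1 = K≥1
  ... | no ¬K≥1 = ⊥-elim (proper λ x y → toJoin x y (single-class n γ Cγ ¬K≥1 x y))

  module Nθ = Nested n θ γ Cθ Cγ (λ x y x∼y → fromJoin x y (inl x∼y)) Kθ≥1 Kγ≥1
  module Nδ = Nested n δ γ Cδ Cγ (λ x y x∼y → fromJoin x y (inr x∼y)) Kδ≥1 Kγ≥1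
  module Θ = Nθ.Θ
  module Δ = Nδ.Θ
  module Γ = Nθ.Γ

  d tθ tδ : ℕ
  d  = gcd fθ fδ
  tθ = _∣_.quotient (gcd[m,n]∣m fθ fδ)
  tδ = _∣_.quotient (gcd[m,n]∣n fθ fδ)

  fθ≡ : fθ ≡ tθ * d
  fθ≡ = _∣_.equality (gcd[m,n]∣m fθ fδ)

  fδ≡ : fδ ≡ tδ * d
  fδ≡ = _∣_.equality (gcd[m,n]∣n fθ fδ)

  proper-part : ∀ f t → f ≡ t * d → f ≢ 0 → 1 < d → (t ≢ 0) × (t < f)
  proper-part f t f≡ f≢0 1<d = t≢0 , subst (t <_) (sym f≡) (m<m*n t d {{≢-nonZero t≢0}} 1<d)
    where
    t≢0 : t ≢ 0
    t≢0 t≡0 = f≢0 (trans f≡ (cong (_* d) t≡0))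

  no-common-divisor : d ≢ 1 → ⊥
  no-common-divisor d≢1 = no-common-extreme common
    where
    fθ≢0 : fθ ≢ 0
    fθ≢0 e = Θ.moves-nonzero (trans hθ (cong (_* step θ) e))
    fδ≢0 : fδ ≢ 0
    fδ≢0 e = Δ.moves-nonzero (trans hδ (cong (_* step δ) e))
    1<d : 1 < d
    1<d = ≤∧≢⇒< (n≢0⇒n>0 λ d≡0 → fθ≢0 (trans fθ≡ (trans (cong (tθ *_) d≡0) (*-zeroʳ tθ))))
                λ e → d≢1 (sym e)
    tθ≢0 : tθ ≢ 0
    tθ≢0 = proj₁ (proper-part fθ tθ fθ≡ fθ≢0 1<d)
    tθ<fθ : tθ < fθ
    tθ<fθ = proj₂ (proper-part fθ tθ fθ≡ fθ≢0 1<d)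
    tδ<fδ : tδ < fδ
    tδ<fδ = proj₂ (proper-part fδ tδ fδ≡ fδ≢0 1<d)

    -- The points where θ, resp. δ, has made tθ, resp. tδ, half waves ...
    θ-point : Σ ℕ λ i → i ≤ n × moves Θ.q i ≡ tθ * step θ
    θ-point = moves-intermediate Θ.q n _ (subst (tθ * step θ ≤_) (sym hθ) (*-monoˡ-≤ (step θ) (<⇒≤ tθ<fθ)))
    δ-point : Σ ℕ λ j → j ≤ n × moves Δ.q j ≡ tδ * step δ
    δ-point = moves-intermediate Δ.q n _ (subst (tδ * step δ ≤_) (sym hδ) (*-monoˡ-≤ (step δ) (<⇒≤ tδ<fδ)))
    i j : ℕ
    i = proj₁ θ-point
    j = proj₁ δ-point
    i≤n : i ≤ n
    i≤n = proj₁ (proj₂ θ-point)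
    j≤n : j ≤ n
    j≤n = proj₁ (proj₂ δ-point)
    θ-whole : moves Θ.q i ≡ tθ * step θ
    θ-whole = proj₂ (proj₂ θ-point)
    δ-whole : moves Δ.q j ≡ tδ * step δ
    δ-whole = proj₂ (proj₂ δ-point)

    -- ... are reached after the same number of γ-moves, namely 1/d of them;
    γ-same : moves Γ.q i ≡ moves Γ.q j
    γ-same = *-cancelˡ-≡ _ _ d {{>-nonZero (<⇒≤ 1<d)}}
               (trans (Nθ.moves-fraction fθ tθ d i i≤n hθ fθ≡ θ-whole)
                      (sym (Nδ.moves-fraction fδ tδ d j j≤n hδ fδ≡ δ-whole)))

    -- so γ rests between them, and the later one is an extreme of both θ and δ.
    common : Σ ℕ λ e → e ≤ n × moves Θ.q e ≡ tθ * step θ × moves Δ.q e ≡ tδ * step δ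
    common with ≤-total i j
    ... | inj₁ i≤j = j , j≤n , Nθ.catch-up i j tθ i≤j j≤n θ-whole (sym γ-same) , δ-whole
    ... | inj₂ j≤i = i , i≤n , θ-whole , Nδ.catch-up j i tδ j≤i i≤n δ-whole γ-same

    -- But the only common extremes are 0 and n, where θ has made 0 resp. fθ half waves.
    no-common-extreme : (Σ ℕ λ e → e ≤ n × moves Θ.q e ≡ tθ * step θ × moves Δ.q e ≡ tδ * step δ) → ⊥
    no-common-extreme (e , e≤n , θ-e , δ-e)
      with Equivalence.to (extremes (point n e))
             (Θ.extreme (point n e) (Θ.extreme-at-multiple e tθ e≤n θ-e) ,
              Δ.extreme (point n e) (Δ.extreme-at-multiple e tδ e≤n δ-e))
    ... | inj₁ at0 with trans (sym (toℕ-point n e e≤n)) at0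
    ...   | refl with m*n≡0⇒m≡0∨n≡0 tθ (sym θ-e)
    ...     | inj₁ tθ≡0 = tθ≢0 tθ≡0
    ...     | inj₂ K≡0  = <⇒≢ Kθ≥1 (sym K≡0)
    no-common-extreme (e , e≤n , θ-e , δ-e) | inj₂ atn with trans (sym (toℕ-point n e e≤n)) atn
    ... | refl = <⇒≢ tθ<fθ (sym (*-cancelʳ-≡ fθ tθ (step θ) {{>-nonZero Kθ≥1}} (trans (sym hθ) θ-e)))

lemma5p14 : (n : ℕ) → 1 ≤ n → (θ δ : BRel (suc n)) →
    IsCongruence n θ → IsCongruence n δ →
    1 < classes θ → 1 < classes δ →
    (∀ e → (IsExtreme θ e × IsExtreme δ e) ⇔ ((toℕ e ≡ 0) ⊎ (toℕ e ≡ n))) →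
    ¬ (∀ x y → Join θ δ x y) →
    Σ ℕ λ fθ → Σ ℕ λ fδ →
    (fθ * step θ ≡ n ∸ rests θ) × (fδ * step δ ≡ n ∸ rests δ) × (gcd fθ fδ ≡ 1)
lemma5p14 n _ θ δ Cθ Cδ θ-classes δ-classes extremes proper =
  fθ , fδ , trans (sym hθ) Θ.moves≡ , trans (sym hδ) Δ.moves≡ , coprime
  where
  Kθ≥1 : 1 ≤ step θ
  Kθ≥1 = ∸-monoˡ-≤ 1 θ-classes
  Kδ≥1 : 1 ≤ step δ
  Kδ≥1 = ∸-monoˡ-≤ 1 δ-classes
  module Θ = Congruence n θ Cθ Kθ≥1
  module Δ = Congruence n δ Cδ Kδ≥1
  fθ fδ : ℕ
  fθ = proj₁ Θ.frequency
  fδ = proj₁ Δ.frequency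
  hθ : moves Θ.q n ≡ fθ * step θ
  hθ = proj₂ Θ.frequency
  hδ : moves Δ.q n ≡ fδ * step δ
  hδ = proj₂ Δ.frequency
  coprime : gcd fθ fδ ≡ 1
  coprime with gcd fθ fδ ≟ 1
  ... | yes d≡1 = d≡1
  ... | no d≢1  = ⊥-elim (¬¬-decidable (Join θ δ) λ dec →
    CommonDivisor.no-common-divisor n θ δ Cθ Cδ Kθ≥1 Kδ≥1 extremes proper fθ fδ hθ hδ dec d≢1)
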